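{- For any connected finite simple graph $G$ of order $n \ge 2$, $\gamma(M(G\circ K_1)) = n$.
   Context: The corona $G\circ K_1$ is the graph of order $2|V(G)|$ obtained from $G$ by adding, for each vertex $v$ of $G$, a new vertex $v'$ and the pendant edge $vv'$. For a finite simple graph $H$, the middle graph $M(H)$ is the graph with vertex set $V(H)\cup E(H)$ in which two elements $x,y$ are adjacent if and only if either (1) $x,y\in E(H)$ and the edges $x,y$ share a common endpoint in $H$, or (2) $x\in V(H)$, $y\in E(H)$ and $x$ is an endpoint of $y$ (or vice versa). A dominating set of a graph $H$ is a set $S\subseteq V(H)$ such that every vertex of $H$ is in $S$ or adjacent to a vertex of $S$; the domination number $\gamma(H)$ is the minimum cardinality of a dominating set of $H$. -}

module Defs where

open import Data.Nat using (ℕ; _+_; _≤_)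
open import Data.Fin using (Fin; splitAt; _<?_)
open import Data.Fin.Properties using (_≟_)
open import Data.Bool using (Bool; true; false; T; _∧_; _∨_; not)
open import Data.Sum using (_⊎_; inj₁; inj₂)
open import Data.Product using (Σ; _×_; _,_; proj₁; proj₂; ∃-syntax)
open import Data.List using (List; length)
open import Data.List.Membership.Propositional using (_∈_)
open import Data.List.Relation.Unary.Unique.Propositional using (Unique)
open import Relation.Nullary.Decidable using (⌊_⌋)
open import Relation.Binary.PropositionalEquality using (_≡_)

record Graph (n : ℕ) : Set where
  field
    adj     : Fin n → Fin n → Bool
    adj-sym : ∀ u v → adj u v ≡ adj v u
    adj-irr : ∀ v → adj v v ≡ false
open Graph public

data Walk {V : Set} (a : V → V → Bool) : V → V → Set where
  here : ∀ {v} → Walk a v v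
  step : ∀ {u v w} → T (a u v) → Walk a v w → Walk a u w

Connected : ∀ {n} → Graph n → Set
Connected G = ∀ u v → Walk (adj G) u v

-- Corona G ∘ K₁ on vertex set Fin (n + n): via splitAt n, the left copy
-- (inj₁ v) is v ∈ V(G) and the right copy (inj₂ v) is the pendant vertex v'.
coronaAdj : ∀ {n} → Graph n → Fin (n + n) → Fin (n + n) → Bool
coronaAdj {n} G x y with splitAt n x | splitAt n y
... | inj₁ u | inj₁ v = adj G u v
... | inj₁ u | inj₂ v = ⌊ u ≟ v ⌋
... | inj₂ u | inj₁ v = ⌊ u ≟ v ⌋
... | inj₂ u | inj₂ v = false

-- Edges of a graph on Fin m given by adjacency a: unordered pairs {u,v}
-- represented canonically as (u , v) with u < v and u ~ v.
isEdge : ∀ {m} → (Fin m → Fin m → Bool) → Fin m → Fin m → Bool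
isEdge a u v = ⌊ u <? v ⌋ ∧ a u v

Edge : ∀ {m} → (Fin m → Fin m → Bool) → Set
Edge {m} a = Σ (Fin m × Fin m) (λ p → T (isEdge a (proj₁ p) (proj₂ p)))

_==_ : ∀ {m} → Fin m → Fin m → Bool
x == y = ⌊ x ≟ y ⌋

middleAdj : ∀ {m} (a : Fin m → Fin m → Bool) →
            (Fin m ⊎ Edge a) → (Fin m ⊎ Edge a) → Bool
middleAdj a (inj₁ x) (inj₁ y) = false
middleAdj a (inj₁ x) (inj₂ ((u , v) , _)) = (x == u) ∨ (x == v)
middleAdj a (inj₂ ((u , v) , _)) (inj₁ x) = (x == u) ∨ (x == v)
middleAdj a (inj₂ ((p , q) , _)) (inj₂ ((r , s) , _)) =
  not ((p == r) ∧ (q == s)) ∧ ((p == r) ∨ (p == s) ∨ (q == r) ∨ (q == s))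

Dominating : ∀ {V : Set} → (V → V → Bool) → List V → Set
Dominating {V} a S = ∀ (x : V) → x ∈ S ⊎ (∃[ y ] (y ∈ S × T (a y x)))

DominationNumber : ∀ {V : Set} → (V → V → Bool) → ℕ → Set
DominationNumber {V} a k =
  (∃[ S ] (Unique S × Dominating a S × length S ≡ k)) ×
  (∀ (S : List V) → Unique S → Dominating a S → k ≤ length S)

module Submission where

-- Write the vertices of G ∘ K₁ as v ↑ˡ n (a vertex v of G) and
-- n ↑ʳ v (its pendant copy v'), and let p_v be the pendant edge v v'.  In the
-- middle graph M(G ∘ K₁):
--   * Upper bound: the n pendant edges dominate.  Every vertex v or v' of
--     G ∘ K₁ is incident to p_v.  Every edge of G ∘ K₁ has its smaller endpoint
--     in G, say v; so it either is p_v or shares the endpoint v with p_v.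
--   * Lower bound: in M(G ∘ K₁) the vertex v' is adjacent only to p_v, so a
--     dominating set S meets the closed neighbourhood {v', p_v} for every v.
--     The map sending v, v' and every edge with smaller endpoint v to v sends
--     both v' and p_v to v, hence maps S onto the n vertices of G: |S| ≥ n.

open import Defs
open import Data.Nat using (ℕ; _+_; _≤_)
open import Data.Nat.Properties using (<-≤-trans; m≤m+n; <-irrefl; <-asym)
open import Data.Fin using (Fin; toℕ; splitAt; _↑ˡ_; _↑ʳ_; _<_; _<?_)
open import Data.Fin.Properties
  using (_≟_; toℕ<n; toℕ-↑ˡ; toℕ-↑ʳ; splitAt-↑ˡ; splitAt-↑ʳ;
         splitAt⁻¹-↑ˡ; splitAt⁻¹-↑ʳ; ↑ˡ-injective; injective⇒≤)
open import Data.Bool using (Bool; false; T)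
open import Data.Bool.Properties using (T-∧; T-∨; T-irrelevant)
open import Data.Unit using (tt)
open import Data.Empty using (⊥-elim)
open import Data.Sum using (_⊎_; inj₁; inj₂; [_,_]′)
import Data.Sum as Sum
open import Data.Product using (_×_; _,_; proj₁; proj₂; ∃-syntax)
open import Data.List using (List; length; tabulate; lookup)
open import Data.List.Properties using (length-tabulate)
open import Data.List.Membership.Propositional using (_∈_)
open import Data.List.Membership.Propositional.Properties using (∈-tabulate⁺)
open import Data.List.Relation.Unary.Any using (index)
open import Data.List.Relation.Unary.Any.Properties using (lookup-index)
open import Data.List.Relation.Unary.Unique.Propositional using (Unique)
open import Data.List.Relation.Unary.Unique.Propositional.Properties using (tabulate⁺)
open import Function.Bundles using (Equivalence)
open import Relation.Nullary using (yes; no)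
open import Relation.Nullary.Decidable using (⌊_⌋; toWitness; fromWitness)
open import Relation.Binary.PropositionalEquality
  using (_≡_; _≢_; refl; sym; trans; cong; subst)

open Equivalence using (to; from)

-- Counting: if f maps the entries of a list onto Fin k, the list has at
-- least k entries (choosing a position of a preimage of each i is injective).
onto⇒≤ : ∀ {k} {A : Set} (f : A → Fin k) (S : List A) →
         (∀ i → ∃[ x ] (x ∈ S × f x ≡ i)) → k ≤ length S
onto⇒≤ {k} f S onto = injective⇒≤ {f = position} position-injective
  where
    position : Fin k → Fin (length S)
    position i = index (proj₁ (proj₂ (onto i)))

    f-at-position : ∀ i → f (lookup S (position i)) ≡ i
    f-at-position i =
      trans (cong f (sym (lookup-index (proj₁ (proj₂ (onto i)))))) (proj₂ (proj₂ (onto i)))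

    position-injective : ∀ {i j} → position i ≡ position j → i ≡ j
    position-injective {i} {j} eq =
      trans (sym (f-at-position i))
            (trans (cong (λ p → f (lookup S p)) eq) (f-at-position j))

module MiddleGraph {m : ℕ} (a : Fin m → Fin m → Bool) where

  tail head : Edge a → Fin m
  tail ((u , _) , _) = u
  head ((_ , v) , _) = v

  mkEdge : ∀ u v → u < v → T (a u v) → Edge a
  mkEdge u v u<v uv = (u , v) , from (T-∧ {⌊ u <? v ⌋}) (fromWitness u<v , uv)

  edge-ordered : ∀ e → tail e < head e
  edge-ordered ((u , v) , isEdge-uv) = toWitness (proj₁ (to (T-∧ {⌊ u <? v ⌋}) isEdge-uv))

  edge-adjacent : ∀ e → T (a (tail e) (head e))
  edge-adjacent ((u , v) , isEdge-uv) = proj₂ (to (T-∧ {⌊ u <? v ⌋}) isEdge-uv)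

  Incident : Fin m → Edge a → Set
  Incident x e = x ≡ tail e ⊎ x ≡ head e

  edge-≡ : ∀ {u v p q} → _≡_ {A = Edge a} ((u , v) , p) ((u , v) , q)
  edge-≡ {p = p} {q} rewrite T-irrelevant p q = refl

  incident⇒adjacent : ∀ x e → Incident x e → T (middleAdj a (inj₂ e) (inj₁ x))
  incident⇒adjacent x ((u , v) , _) inc =
    from (T-∨ {x == u}) (Sum.map fromWitness fromWitness inc)

  vertex-neighbour : ∀ y x → T (middleAdj a y (inj₁ x)) →
                     ∃[ e ] (y ≡ inj₂ e × Incident x e)
  vertex-neighbour (inj₂ e@((u , v) , _)) x adjacent =
    e , refl , Sum.map toWitness toWitness (to (T-∨ {x == u}) adjacent)

  common-tail⇒adjacent : ∀ e f → tail e ≡ tail f → head e ≢ head f →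
                         T (middleAdj a (inj₂ e) (inj₂ f))
  common-tail⇒adjacent ((p , q) , _) ((.p , s) , _) refl q≢s with p ≟ p | q ≟ s
  ... | no p≢p | _      = ⊥-elim (p≢p refl)
  ... | yes _  | yes q≡s = ⊥-elim (q≢s q≡s)
  ... | yes _  | no _   = tt

module Corona {n : ℕ} (G : Graph n) where

  A : Fin (n + n) → Fin (n + n) → Bool
  A = coronaAdj G

  open MiddleGraph A

  data Side : Fin (n + n) → Set where
    vertex  : ∀ u → Side (u ↑ˡ n)
    pendant : ∀ u → Side (n ↑ʳ u)

  side : ∀ x → Side x
  side x with splitAt n x in eq
  ... | inj₁ u = subst Side (splitAt⁻¹-↑ˡ eq) (vertex u)
  ... | inj₂ u = subst Side (splitAt⁻¹-↑ʳ eq) (pendant u)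

  vertex<pendant : ∀ (u v : Fin n) → u ↑ˡ n < n ↑ʳ v
  vertex<pendant u v rewrite toℕ-↑ˡ u n | toℕ-↑ʳ n v =
    <-≤-trans (toℕ<n u) (m≤m+n n (toℕ v))

  vertex≢pendant : ∀ (u v : Fin n) → u ↑ˡ n ≢ n ↑ʳ v
  vertex≢pendant u v eq = <-irrefl (cong toℕ eq) (vertex<pendant u v)

  adj-vertex-pendant : ∀ (u v : Fin n) → A (u ↑ˡ n) (n ↑ʳ v) ≡ (u == v)
  adj-vertex-pendant u v rewrite splitAt-↑ˡ n u n | splitAt-↑ʳ n n v = refl

  adj-pendant-pendant : ∀ (u v : Fin n) → A (n ↑ʳ u) (n ↑ʳ v) ≡ false
  adj-pendant-pendant u v rewrite splitAt-↑ʳ n n u | splitAt-↑ʳ n n v = refl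

  pendantEdge : Fin n → Edge A
  pendantEdge u = mkEdge (u ↑ˡ n) (n ↑ʳ u) (vertex<pendant u u)
                        (subst T (sym (adj-vertex-pendant u u)) (fromWitness refl))

  -- The smaller endpoint of every edge of G ∘ K₁ is a vertex of G: a pendant
  -- vertex is adjacent only to a vertex of G, which comes before it.
  tail-in-G : ∀ e → ∃[ u ] (tail e ≡ u ↑ˡ n)
  tail-in-G e@((x , y) , _) with side x | side y | edge-ordered e | edge-adjacent e
  ... | vertex u  | _         | _   | _  = u , refl
  ... | pendant u | vertex v  | x<y | _  = ⊥-elim (<-asym x<y (vertex<pendant v u))
  ... | pendant u | pendant v | _   | xy = ⊥-elim (subst T (adj-pendant-pendant u v) xy)

  pendant-incident : ∀ v e → Incident (n ↑ʳ v) e → e ≡ pendantEdge v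
  pendant-incident v e (inj₁ v'≡x) with tail-in-G e
  ... | u , x≡u = ⊥-elim (vertex≢pendant u v (sym (trans v'≡x x≡u)))
  pendant-incident v e@((x , .(n ↑ʳ v)) , _) (inj₂ refl) with side x | edge-adjacent e
  ... | vertex u  | xy with refl ← toWitness (subst T (adj-vertex-pendant u v) xy) = edge-≡
  ... | pendant u | xy = ⊥-elim (subst T (adj-pendant-pendant u v) xy)

  V : Set
  V = Fin (n + n) ⊎ Edge A

  owner : Fin (n + n) → Fin n
  owner x = [ (λ u → u) , (λ u → u) ]′ (splitAt n x)

  ownerM : V → Fin n
  ownerM (inj₁ x) = owner x
  ownerM (inj₂ e) = owner (tail e)

  owner-vertex : ∀ (u : Fin n) → owner (u ↑ˡ n) ≡ u
  owner-vertex u rewrite splitAt-↑ˡ n u n = refl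

  owner-pendant : ∀ (u : Fin n) → owner (n ↑ʳ u) ≡ u
  owner-pendant u rewrite splitAt-↑ʳ n n u = refl

  -- Lower bound: a dominating set contains v' or p_v, both owned by v.
  dominating⇒≥ : ∀ S → Dominating (middleAdj A) S → n ≤ length S
  dominating⇒≥ S dominating = onto⇒≤ ownerM S meets
    where
      meets : ∀ v → ∃[ y ] (y ∈ S × ownerM y ≡ v)
      meets v with dominating (inj₁ (n ↑ʳ v))
      ... | inj₁ v'∈S = _ , v'∈S , owner-pendant v
      ... | inj₂ (y , y∈S , adjacent) with vertex-neighbour y _ adjacent
      ...   | e , refl , incident with pendant-incident v e incident
      ...     | refl = _ , y∈S , owner-vertex v

  pendantEdges : List V
  pendantEdges = tabulate (λ u → inj₂ (pendantEdge u))

  pendantEdges-unique : Unique pendantEdges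
  pendantEdges-unique = tabulate⁺ λ {u} {v} eq → ↑ˡ-injective n u v (cong tailM eq)
    where
      tailM : V → Fin (n + n)
      tailM (inj₁ x) = x
      tailM (inj₂ e) = tail e

  -- v and v' are incident to p_v; an edge with smaller endpoint u is p_u or
  -- shares the endpoint u with p_u.
  pendantEdges-dominate : Dominating (middleAdj A) pendantEdges
  pendantEdges-dominate (inj₁ x) with side x
  ... | vertex u  = inj₂ (_ , ∈-tabulate⁺ u , incident⇒adjacent _ (pendantEdge u) (inj₁ refl))
  ... | pendant u = inj₂ (_ , ∈-tabulate⁺ u , incident⇒adjacent _ (pendantEdge u) (inj₂ refl))
  pendantEdges-dominate (inj₂ e@((_ , y) , _)) with tail-in-G e
  ... | u , refl with y ≟ n ↑ʳ u
  ...   | yes refl = inj₁ (subst (_∈ pendantEdges) (cong inj₂ edge-≡) (∈-tabulate⁺ u))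
  ...   | no y≢u' =
    inj₂ (_ , ∈-tabulate⁺ u ,
          common-tail⇒adjacent (pendantEdge u) e refl (λ u'≡y → y≢u' (sym u'≡y)))

theorem2p12 : (n : ℕ) → 2 ≤ n → (G : Graph n) → Connected G →
    DominationNumber (middleAdj (coronaAdj G)) n
theorem2p12 n _ G _ =
  (pendantEdges , pendantEdges-unique , pendantEdges-dominate , length-tabulate _) ,
  (λ S _ dominating → dominating⇒≥ S dominating)
  where open Corona G
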